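{- Let $V$ be a finite set, $\mathcal{R}$ a dense set of rooted triplets on $V$, and $T$ a rooted binary tree over $V$. Let $\{a,b,c,d\}\subseteq V$ be four leaves such that $t=bc|a$ is the only triplet of $\mathcal{R}[\{a,b,c,d\}]$ inconsistent with $T$. Then $\mathcal{R}[\{a,b,c,d\}]$ is inconsistent (i.e. $\{a,b,c,d\}$ is a conflict) if and only if $d\in span(t)$.
   Context: A rooted triplet on $\{a,b,c\}$ is a rooted binary tree with leaves $a,b,c$; $ab|c$ denotes the one in which $a,b$ are siblings and $c$ is a child of the root. $\mathcal{R}$ is dense if it contains exactly one rooted triplet on each 3-subset of $V$. A rooted binary tree over $V$ is one whose leaves are in bijection with $V$. For $S\subseteq V$, $\mathcal{R}[S]=\{t\in\mathcal{R}: V(t)\subseteq S\}$ and $T_{|S}$ is the tree on $S$ homeomorphic to the subtree of $T$ spanning $S$; $t$ is consistent with $T$ if $T_{|V(t)}=t$. A set of triplets on $S$ is consistent if some rooted binary tree over $S$ is consistent with all of them, and inconsistent otherwise; a conflict is a set $C$ of leaves with $\mathcal{R}[C]$ inconsistent. For a triplet $t$ on $\{a,b,c\}$, $span(t)$ is the set of leaves of $T$ in the subtree rooted at the least common ancestor of $a,b,c$ in $T$. -}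

module Defs where

open import Data.Nat using (ℕ)
open import Data.Fin using (Fin; _≟_)
open import Data.Bool using (Bool; true; false; _∧_)
open import Data.List using (List; []; _∷_; _++_)
open import Data.Bool.ListAction using (any; all)
open import Data.List.Membership.Propositional using (_∈_)
open import Data.List.Relation.Unary.Unique.Propositional using (Unique)
open import Data.Maybe using (Maybe; just; nothing)
open import Data.Product using (_×_; ∃)
open import Data.Sum using (_⊎_)
open import Relation.Nullary using (¬_; does)
open import Relation.Binary.PropositionalEquality using (_≡_; _≢_)
open import Function.Bundles using (_⇔_)

data Tree (n : ℕ) : Set where
  leaf : Fin n → Tree n
  node : Tree n → Tree n → Tree n

module _ {n : ℕ} where

  leaves : Tree n → List (Fin n)
  leaves (leaf v)   = v ∷ []
  leaves (node l r) = leaves l ++ leaves r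

  -- Equality of rooted (unordered) trees: isomorphism up to swapping children.
  data _≅_ : Tree n → Tree n → Set where
    leaf≅ : ∀ v → leaf v ≅ leaf v
    node≅ : ∀ {l r l' r'} → l ≅ l' → r ≅ r' → node l r ≅ node l' r'
    swap≅ : ∀ {l r l' r'} → l ≅ r' → r ≅ l' → node l r ≅ node l' r'

  TreeOver : (Fin n → Set) → Tree n → Set
  TreeOver S T = Unique (leaves T) × (∀ v → (v ∈ leaves T) ⇔ S v)

  elem : Fin n → List (Fin n) → Bool
  elem x ys = any (λ y → does (x ≟ y)) ys

  -- T_{|S}: the tree homeomorphic to the subtree of T spanning S
  -- (prune leaves outside S, suppress resulting unary nodes);
  -- nothing if S contains no leaf of T.
  restrict : (Fin n → Bool) → Tree n → Maybe (Tree n)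
  restrict S (leaf v) with S v
  ... | true  = just (leaf v)
  ... | false = nothing
  restrict S (node l r) with restrict S l | restrict S r
  ... | just l' | just r' = just (node l' r')
  ... | just l' | nothing = just l'
  ... | nothing | just r' = just r'
  ... | nothing | nothing = nothing

  ConsistentWith : Tree n → Fin n → Fin n → Fin n → Set
  ConsistentWith T x y z =
    ∃ λ t → (restrict (λ v → elem v (x ∷ y ∷ z ∷ [])) T ≡ just t)
          × (t ≅ node (node (leaf x) (leaf y)) (leaf z))

  -- A set of rooted triplets on V is a predicate R with R x y z meaning xy|z ∈ R.
  Dense : (Fin n → Fin n → Fin n → Set) → Set
  Dense R =
      (∀ x y z → R x y z → (x ≢ y) × (y ≢ z) × (x ≢ z))
    × (∀ x y z → R x y z → R y x z)
    × (∀ a b c → a ≢ b → b ≢ c → a ≢ c →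
          (R b c a ⊎ R a c b ⊎ R a b c)
        × ¬ (R b c a × R a c b) × ¬ (R b c a × R a b c) × ¬ (R a c b × R a b c))

  InS : List (Fin n) → Fin n → Set
  InS S v = v ∈ S

  ConsistentOn : (Fin n → Fin n → Fin n → Set) → List (Fin n) → Set
  ConsistentOn R S =
    ∃ λ (T' : Tree n) → TreeOver (InS S) T'
      × (∀ x y z → x ∈ S → y ∈ S → z ∈ S → R x y z → ConsistentWith T' x y z)

  -- span of the triplet on X in T: the leaves of the subtree of T rooted
  -- at the least common ancestor of the leaves in X.
  span : List (Fin n) → Tree n → List (Fin n)
  span X (leaf v) = v ∷ []
  span X (node l r) with all (λ x → elem x (leaves l)) X | all (λ x → elem x (leaves r)) X
  ... | true  | _     = span X l
  ... | false | true  = span X r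
  ... | false | false = leaves (node l r)

-- Write xy|z ∈ T when T displays xy|z. Displaying and being consistent coincide for
-- distinct leaves, and R agrees with T on every triplet of {a,b,c,d} except bc|a, in
-- particular on every triplet containing d.
-- If d ∉ span(bc|a), then xy|d ∈ T for all x, y ∈ {a,b,c}, so the tree ((a,(b,c)),d)
-- displays every triplet of R[{a,b,c,d}].
-- If d ∈ span(bc|a), then T displays aq|r with {q,r} = {b,c}, and d either joins the
-- side of a, q (giving ad|r, qd|r ∈ R) or that of r (giving rd|a, rd|q, aq|d ∈ R).
-- A tree consistent with R displays qr|a, so inserting d yields qr|d, or qd|a and rd|a;
-- each option contradicts one of the triplets above.
module Submission where

open import Defs
open import Data.Bool using (Bool; true; false)
open import Data.Bool.ListAction using (all)
open import Data.Bool.Properties using (¬-not)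
open import Data.Empty using (⊥; ⊥-elim)
open import Data.Fin using (Fin; _≟_)
open import Data.List using (List; []; _∷_; _++_)
import Data.List.Membership.DecPropositional as DecMembership
open import Data.List.Membership.Propositional using (_∈_; _∉_)
open import Data.List.Membership.Propositional.Properties using (∈-++⁺ˡ; ∈-++⁺ʳ; ∈-++⁻)
open import Data.List.Relation.Binary.Subset.Propositional using (_⊆_)
open import Data.List.Relation.Unary.All as All using (All; []; _∷_)
open import Data.List.Relation.Unary.All.Properties using (++⁺; ++⁻ˡ; ++⁻ʳ)
open import Data.List.Relation.Unary.AllPairs using ([]; _∷_)
open import Data.List.Relation.Unary.Any using (here; there)
open import Data.List.Relation.Unary.Any.Properties using () renaming (++-comm to ∈-++-comm)
open import Data.List.Relation.Unary.Unique.Propositional using (Unique)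
open import Data.Maybe using (just; nothing)
open import Data.Maybe.Properties using (just-injective)
open import Data.Nat using (ℕ)
open import Data.Product as Product using (_×_; _,_; ∃; proj₁; proj₂)
open import Data.Sum as Sum using (_⊎_; inj₁; inj₂; [_,_]′)
open import Data.Unit using (⊤; tt)
open import Function using (id; _∘_)
open import Function.Bundles using (_⇔_; mk⇔; Equivalence)
open import Relation.Binary.PropositionalEquality using (_≡_; _≢_; refl; sym; trans; subst)
open import Relation.Nullary using (¬_; yes; no; does; contradiction)
open import Relation.Nullary.Decidable using (dec-true; decidable-stable)

module _ {n : ℕ} where

  private variable
    t l r : Tree n
    d u v w x y z : Fin n
    xs ys zs : List (Fin n)

  ∈⇒elem : ∀ ys → x ∈ ys → elem x ys ≡ true
  ∈⇒elem {x} _        (here refl) rewrite dec-true (x ≟ x) refl = refl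
  ∈⇒elem {x} (y ∷ ys) (there m) with does (x ≟ y)
  ... | true  = refl
  ... | false = ∈⇒elem ys m

  elem⇒∈ : elem x ys ≡ true → x ∈ ys
  elem⇒∈ {x} {y ∷ _} e with x ≟ y
  ... | yes x≡y = here x≡y
  ... | no _    = there (elem⇒∈ e)

  ⊆⇒all-elem : xs ⊆ ys → all (λ v → elem v ys) xs ≡ true
  ⊆⇒all-elem {[]}     _   = refl
  ⊆⇒all-elem {_ ∷ xs} sub rewrite ∈⇒elem _ (sub (here refl)) = ⊆⇒all-elem (λ m → sub (there m))

  all-elem⇒⊆ : all (λ v → elem v ys) xs ≡ true → xs ⊆ ys
  all-elem⇒⊆ {ys} {x ∷ _} e m with elem x ys in ex
  all-elem⇒⊆ e (here refl) | true = elem⇒∈ ex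
  all-elem⇒⊆ e (there m)   | true = all-elem⇒⊆ e m

  unique-++ˡ : Unique (xs ++ ys) → Unique xs
  unique-++ˡ {[]}     _          = []
  unique-++ˡ {x ∷ xs} (x≢ ∷ un) = ++⁻ˡ xs x≢ ∷ unique-++ˡ un

  unique-++ʳ : ∀ xs → Unique (xs ++ ys) → Unique ys
  unique-++ʳ []       un       = un
  unique-++ʳ (_ ∷ xs) (_ ∷ un) = unique-++ʳ xs un

  unique-++-disjoint : Unique (xs ++ ys) → x ∈ xs → x ∉ ys
  unique-++-disjoint {_ ∷ xs} (x≢ ∷ _)  (here refl) m = All.lookup (++⁻ʳ xs x≢) m refl
  unique-++-disjoint          (_ ∷ un)  (there m)   m' = unique-++-disjoint un m m'

  -- lca(x,y) lies strictly below lca(x,y,z) in t.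
  data Displays : Tree n → Fin n → Fin n → Fin n → Set where
    inL   : Displays l x y z → Displays (node l r) x y z
    inR   : Displays r x y z → Displays (node l r) x y z
    rootL : x ∈ leaves l → y ∈ leaves l → z ∈ leaves r → Displays (node l r) x y z
    rootR : x ∈ leaves r → y ∈ leaves r → z ∈ leaves l → Displays (node l r) x y z

  displays-leaves : Displays t x y z → x ∈ leaves t × y ∈ leaves t × z ∈ leaves t
  displays-leaves {node l r} (inL s) with displays-leaves s
  ... | xl , yl , zl = ∈-++⁺ˡ xl , ∈-++⁺ˡ yl , ∈-++⁺ˡ zl
  displays-leaves {node l r} (inR s) with displays-leaves s
  ... | xr , yr , zr = ∈-++⁺ʳ (leaves l) xr , ∈-++⁺ʳ (leaves l) yr , ∈-++⁺ʳ (leaves l) zr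
  displays-leaves {node l r} (rootL xl yl zr) = ∈-++⁺ˡ xl , ∈-++⁺ˡ yl , ∈-++⁺ʳ (leaves l) zr
  displays-leaves {node l r} (rootR xr yr zl) =
    ∈-++⁺ʳ (leaves l) xr , ∈-++⁺ʳ (leaves l) yr , ∈-++⁺ˡ zl

  displays-swap : Displays t x y z → Displays t y x z
  displays-swap (inL s)          = inL (displays-swap s)
  displays-swap (inR s)          = inR (displays-swap s)
  displays-swap (rootL xl yl zr) = rootL yl xl zr
  displays-swap (rootR xr yr zl) = rootR yr xr zl

  displays-trichotomy : x ≢ y → x ∈ leaves t → y ∈ leaves t → z ∈ leaves t
    → Displays t x y z ⊎ Displays t x z y ⊎ Displays t y z x
  displays-trichotomy {t = leaf _} x≢y (here refl) (here refl) _ = ⊥-elim (x≢y refl)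
  displays-trichotomy {t = node l r} x≢y xm ym zm
    with ∈-++⁻ (leaves l) xm | ∈-++⁻ (leaves l) ym | ∈-++⁻ (leaves l) zm
  ... | inj₁ xl | inj₁ yl | inj₁ zl = Sum.map inL (Sum.map inL inL) (displays-trichotomy x≢y xl yl zl)
  ... | inj₂ xr | inj₂ yr | inj₂ zr = Sum.map inR (Sum.map inR inR) (displays-trichotomy x≢y xr yr zr)
  ... | inj₁ xl | inj₁ yl | inj₂ zr = inj₁ (rootL xl yl zr)
  ... | inj₁ xl | inj₂ yr | inj₁ zl = inj₂ (inj₁ (rootL xl zl yr))
  ... | inj₂ xr | inj₁ yl | inj₁ zl = inj₂ (inj₂ (rootL yl zl xr))
  ... | inj₂ xr | inj₂ yr | inj₁ zl = inj₁ (rootR xr yr zl)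
  ... | inj₂ xr | inj₁ yl | inj₂ zr = inj₂ (inj₁ (rootR xr zr yl))
  ... | inj₁ xl | inj₂ yr | inj₂ zr = inj₂ (inj₂ (rootR yr zr xl))

  displays-exclusive : Unique (leaves t) → Displays t x y z → Displays t x z y → ⊥
  displays-exclusive {node l r} un (inL s) (inL s') = displays-exclusive (unique-++ˡ un) s s'
  displays-exclusive {node l r} un (inR s) (inR s') = displays-exclusive (unique-++ʳ (leaves l) un) s s'
  displays-exclusive {node l r} un (inL s) (inR s') =
    unique-++-disjoint {leaves l} un (proj₁ (displays-leaves s)) (proj₁ (displays-leaves s'))
  displays-exclusive {node l r} un (inL s) (rootL _ _ yr) =
    unique-++-disjoint {leaves l} un (proj₁ (proj₂ (displays-leaves s))) yr
  displays-exclusive {node l r} un (inL s) (rootR xr _ _) =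
    unique-++-disjoint {leaves l} un (proj₁ (displays-leaves s)) xr
  displays-exclusive {node l r} un (inR s) (inL s') =
    unique-++-disjoint {leaves l} un (proj₁ (displays-leaves s')) (proj₁ (displays-leaves s))
  displays-exclusive {node l r} un (inR s) (rootL xl _ _) =
    unique-++-disjoint {leaves l} un xl (proj₁ (displays-leaves s))
  displays-exclusive {node l r} un (inR s) (rootR _ _ yl) =
    unique-++-disjoint {leaves l} un yl (proj₁ (proj₂ (displays-leaves s)))
  displays-exclusive {node l r} un (rootL _ _ zr) (inL s') =
    unique-++-disjoint {leaves l} un (proj₁ (proj₂ (displays-leaves s'))) zr
  displays-exclusive {node l r} un (rootL xl _ _) (inR s') =
    unique-++-disjoint {leaves l} un xl (proj₁ (displays-leaves s'))
  displays-exclusive {node l r} un (rootR xr _ _) (inL s') =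
    unique-++-disjoint {leaves l} un (proj₁ (displays-leaves s')) xr
  displays-exclusive {node l r} un (rootR _ _ zl) (inR s') =
    unique-++-disjoint {leaves l} un zl (proj₁ (proj₂ (displays-leaves s')))
  displays-exclusive {node l r} un (rootL _ yl _) (rootL _ _ yr) = unique-++-disjoint {leaves l} un yl yr
  displays-exclusive {node l r} un (rootL xl _ _) (rootR xr _ _) = unique-++-disjoint {leaves l} un xl xr
  displays-exclusive {node l r} un (rootR xr _ _) (rootL xl _ _) = unique-++-disjoint {leaves l} un xl xr
  displays-exclusive {node l r} un (rootR _ yr _) (rootR _ _ yl) = unique-++-disjoint {leaves l} un yl yr

  displays-insert : x ≢ y → Displays t x y z → w ∈ leaves t
    → Displays t x y w ⊎ (Displays t x w z × Displays t y w z)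
  displays-insert {t = node l r} x≢y (inL s) wm with ∈-++⁻ (leaves l) wm
  ... | inj₁ wl = Sum.map inL (Product.map inL inL) (displays-insert x≢y s wl)
  ... | inj₂ wr = let xl , yl , _ = displays-leaves s in inj₁ (rootL xl yl wr)
  displays-insert {t = node l r} x≢y (inR s) wm with ∈-++⁻ (leaves l) wm
  ... | inj₂ wr = Sum.map inR (Product.map inR inR) (displays-insert x≢y s wr)
  ... | inj₁ wl = let xr , yr , _ = displays-leaves s in inj₁ (rootR xr yr wl)
  displays-insert {t = node l r} x≢y (rootL xl yl zr) wm with ∈-++⁻ (leaves l) wm
  ... | inj₂ wr = inj₁ (rootL xl yl wr)
  ... | inj₁ wl with displays-trichotomy x≢y xl yl wl
  ...   | inj₁ s = inj₁ (inL s)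
  ...   | inj₂ _ = inj₂ (rootL xl wl zr , rootL yl wl zr)
  displays-insert {t = node l r} x≢y (rootR xr yr zl) wm with ∈-++⁻ (leaves l) wm
  ... | inj₁ wl = inj₁ (rootR xr yr wl)
  ... | inj₂ wr with displays-trichotomy x≢y xr yr wr
  ...   | inj₁ s = inj₁ (inR s)
  ...   | inj₂ _ = inj₂ (rootR xr wr zl , rootR yr wr zl)

  apartˡ : Unique (xs ++ ys) → All (_∈ ys) zs → v ∈ xs → v ∉ zs
  apartˡ {xs} un ys⊇zs m vz = unique-++-disjoint {xs} un m (All.lookup ys⊇zs vz)

  apartʳ : ∀ xs → Unique (xs ++ ys) → All (_∈ xs) zs → v ∈ ys → v ∉ zs
  apartʳ xs un xs⊇zs m vz = unique-++-disjoint {xs} un (All.lookup xs⊇zs vz) m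

  module _ (P : Fin n → Bool) where

    record Selects (t : Tree n) (xs : List (Fin n)) : Set where
      constructor selecting
      field
        picked   : All (λ v → P v ≡ true) xs
        selected : v ∈ leaves t → P v ≡ true → v ∈ xs

    open Selects

    selectsˡ : Selects (node l r) xs → Selects l xs
    selectsˡ (selecting p sel) = selecting p λ m → sel (∈-++⁺ˡ m)

    selectsʳ : Selects (node l r) xs → Selects r xs
    selectsʳ {l = l} (selecting p sel) = selecting p λ m → sel (∈-++⁺ʳ (leaves l) m)

    selects-++-comm : ∀ xs → Selects t (xs ++ ys) → Selects t (ys ++ xs)
    selects-++-comm {ys = ys} xs (selecting p sel) =
      selecting (++⁺ (++⁻ʳ xs p) (++⁻ˡ xs p)) λ m q → ∈-++-comm xs ys (sel m q)

    selects-split : ∀ xs → Unique (leaves l ++ leaves r) → Selects (node l r) (xs ++ ys)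
      → All (_∈ leaves l) xs → All (_∈ leaves r) ys → Selects l xs × Selects r ys
    selects-split {l = l} xs un (selecting p sel) xs⊆l ys⊆r =
      selecting (++⁻ˡ xs p) (λ m q → [ id , (λ vy → ⊥-elim (apartˡ {leaves l} un ys⊆r m vy)) ]′
                                         (∈-++⁻ xs (sel (∈-++⁺ˡ m) q))) ,
      selecting (++⁻ʳ xs p) (λ m q → [ (λ vx → ⊥-elim (apartʳ (leaves l) un xs⊆l m vx)) , id ]′
                                         (∈-++⁻ xs (sel (∈-++⁺ʳ (leaves l) m) q)))

    restrict-unselected : (∀ {v} → v ∈ leaves t → P v ≡ false) → restrict P t ≡ nothing
    restrict-unselected {leaf v}   h rewrite h (here refl) = refl
    restrict-unselected {node l r} h
      rewrite restrict-unselected {l} (λ m → h (∈-++⁺ˡ m))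
            | restrict-unselected {r} (λ m → h (∈-++⁺ʳ (leaves l) m)) = refl

    restrict-nodeˡ : ∀ l r → (∀ {v} → v ∈ leaves r → P v ≡ false)
      → restrict P (node l r) ≡ restrict P l
    restrict-nodeˡ l r h rewrite restrict-unselected {r} h with restrict P l
    ... | just _  = refl
    ... | nothing = refl

    restrict-nodeʳ : ∀ l r → (∀ {v} → v ∈ leaves l → P v ≡ false)
      → restrict P (node l r) ≡ restrict P r
    restrict-nodeʳ l r h rewrite restrict-unselected {l} h with restrict P r
    ... | just _  = refl
    ... | nothing = refl

    restrict-node : ∀ l r {l' r'} → restrict P l ≡ just l' → restrict P r ≡ just r'
      → restrict P (node l r) ≡ just (node l' r')
    restrict-node l r el er rewrite el | er = refl

    restrict-inˡ : ∀ l r → Unique (leaves l ++ leaves r) → Selects (node l r) xs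
      → All (_∈ leaves l) xs
      → restrict P (node l r) ≡ restrict P l
    restrict-inˡ l r un sel xs⊆l = restrict-nodeˡ l r λ m →
      ¬-not λ p → apartʳ (leaves l) un xs⊆l m (selected sel (∈-++⁺ʳ (leaves l) m) p)

    restrict-inʳ : ∀ l r → Unique (leaves l ++ leaves r) → Selects (node l r) xs
      → All (_∈ leaves r) xs
      → restrict P (node l r) ≡ restrict P r
    restrict-inʳ l r un sel xs⊆r = restrict-nodeʳ l r λ m →
      ¬-not λ p → apartˡ {leaves l} un xs⊆r m (selected sel (∈-++⁺ˡ m) p)

    restrict-single : Unique (leaves t) → u ∈ leaves t → Selects t (u ∷ [])
      → restrict P t ≡ just (leaf u)
    restrict-single {leaf _}   _  (here refl) (selecting (pu ∷ []) _) rewrite pu = refl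
    restrict-single {node l r} un um sel with ∈-++⁻ (leaves l) um
    ... | inj₁ ul = trans (restrict-inˡ l r un sel (ul ∷ []))
                          (restrict-single (unique-++ˡ un) ul (selectsˡ sel))
    ... | inj₂ ur = trans (restrict-inʳ l r un sel (ur ∷ []))
                          (restrict-single (unique-++ʳ (leaves l) un) ur (selectsʳ sel))

    Restricts-to : Tree n → Tree n → Set
    Restricts-to t s = ∃ λ s' → restrict P t ≡ just s' × s' ≅ s

    restrict-pair : Unique (leaves t) → x ≢ y → x ∈ leaves t → y ∈ leaves t
      → Selects t (x ∷ y ∷ [])
      → Restricts-to t (node (leaf x) (leaf y))
    restrict-pair {leaf _} _ x≢y (here refl) (here refl) _ = ⊥-elim (x≢y refl)
    restrict-pair {node l r} {x} {y} un x≢y xm ym sel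
      with ∈-++⁻ (leaves l) xm | ∈-++⁻ (leaves l) ym
    ... | inj₁ xl | inj₁ yl =
      let s , e , iso = restrict-pair (unique-++ˡ un) x≢y xl yl (selectsˡ sel)
      in s , trans (restrict-inˡ l r un sel (xl ∷ yl ∷ [])) e , iso
    ... | inj₂ xr | inj₂ yr =
      let s , e , iso = restrict-pair (unique-++ʳ (leaves l) un) x≢y xr yr (selectsʳ sel)
      in s , trans (restrict-inʳ l r un sel (xr ∷ yr ∷ [])) e , iso
    ... | inj₁ xl | inj₂ yr =
      let sl , sr = selects-split (x ∷ []) un sel (xl ∷ []) (yr ∷ [])
      in _ , restrict-node l r (restrict-single (unique-++ˡ un) xl sl)
                               (restrict-single (unique-++ʳ (leaves l) un) yr sr)
           , node≅ (leaf≅ x) (leaf≅ y)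
    ... | inj₂ xr | inj₁ yl =
      let sl , sr = selects-split (y ∷ []) un (selects-++-comm (x ∷ []) sel) (yl ∷ []) (xr ∷ [])
      in _ , restrict-node l r (restrict-single (unique-++ˡ un) yl sl)
                               (restrict-single (unique-++ʳ (leaves l) un) xr sr)
           , swap≅ (leaf≅ y) (leaf≅ x)

    restrict-displayed : Unique (leaves t) → x ≢ y → Displays t x y z → Selects t (x ∷ y ∷ z ∷ [])
      → Restricts-to t (node (node (leaf x) (leaf y)) (leaf z))
    restrict-displayed {node l r} un x≢y (inL s) sel =
      let xl , yl , zl = displays-leaves s
          s' , e , iso = restrict-displayed (unique-++ˡ un) x≢y s (selectsˡ sel)
      in s' , trans (restrict-inˡ l r un sel (xl ∷ yl ∷ zl ∷ [])) e , iso
    restrict-displayed {node l r} un x≢y (inR s) sel =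
      let xr , yr , zr = displays-leaves s
          s' , e , iso = restrict-displayed (unique-++ʳ (leaves l) un) x≢y s (selectsʳ sel)
      in s' , trans (restrict-inʳ l r un sel (xr ∷ yr ∷ zr ∷ [])) e , iso
    restrict-displayed {node l r} {x} {y} {z} un x≢y (rootL xl yl zr) sel =
      let sl , sr = selects-split (x ∷ y ∷ []) un sel (xl ∷ yl ∷ []) (zr ∷ [])
          _ , e , iso = restrict-pair (unique-++ˡ un) x≢y xl yl sl
      in _ , restrict-node l r e (restrict-single (unique-++ʳ (leaves l) un) zr sr) , node≅ iso (leaf≅ z)
    restrict-displayed {node l r} {x} {y} {z} un x≢y (rootR xr yr zl) sel =
      let sl , sr = selects-split (z ∷ []) un (selects-++-comm (x ∷ y ∷ []) sel)
                      (zl ∷ []) (xr ∷ yr ∷ [])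
          _ , e , iso = restrict-pair (unique-++ʳ (leaves l) un) x≢y xr yr sr
      in _ , restrict-node l r (restrict-single (unique-++ˡ un) zl sl) e , swap≅ (leaf≅ z) iso

  selects-elem : xs ⊆ ys → ys ⊆ xs → Selects (λ v → elem v xs) t ys
  selects-elem xs⊆ys ys⊆xs =
    selecting (All.tabulate (∈⇒elem _ ∘ ys⊆xs)) λ _ p → xs⊆ys (elem⇒∈ p)

  displays⇒consistent : Unique (leaves t) → x ≢ y → Displays t x y z → ConsistentWith t x y z
  displays⇒consistent un x≢y s = restrict-displayed _ un x≢y s (selects-elem id id)

  ≅-outgroup : ∀ {s} → s ≅ node (node (leaf x) (leaf y)) (leaf z)
    → s ≅ node (node (leaf u) (leaf v)) (leaf w) → z ≡ w
  ≅-outgroup (node≅ _ (leaf≅ _))   (node≅ _ (leaf≅ _))   = refl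
  ≅-outgroup (swap≅ (leaf≅ _) _)   (swap≅ (leaf≅ _) _)   = refl
  ≅-outgroup (node≅ () _)          (swap≅ (leaf≅ _) _)
  ≅-outgroup (swap≅ (leaf≅ _) _)   (node≅ () _)

  consistent-outgroup : Unique (leaves t) → ConsistentWith t x y z → u ≢ v → Displays t u v w
    → (x ∷ y ∷ z ∷ []) ⊆ (u ∷ v ∷ w ∷ []) → (u ∷ v ∷ w ∷ []) ⊆ (x ∷ y ∷ z ∷ [])
    → z ≡ w
  consistent-outgroup un (s , e , iso) u≢v d xyz⊆uvw uvw⊆xyz =
    let _ , e' , iso' = restrict-displayed _ un u≢v d (selects-elem xyz⊆uvw uvw⊆xyz)
    in ≅-outgroup iso (subst (_≅ _) (just-injective (trans (sym e') e)) iso')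

  consistent⇒displays : Unique (leaves t) → x ≢ y → x ≢ z → y ≢ z
    → x ∈ leaves t → y ∈ leaves t → z ∈ leaves t → ConsistentWith t x y z → Displays t x y z
  consistent⇒displays {x = x} {y} {z} un x≢y x≢z y≢z xm ym zm c
    with displays-trichotomy x≢y xm ym zm
  ... | inj₁ xy∣z = xy∣z
  ... | inj₂ (inj₁ xz∣y) = ⊥-elim (y≢z (sym
          (consistent-outgroup un c (x≢z ∘ sym) (displays-swap xz∣y)
            (∈-++-comm (x ∷ y ∷ []) (z ∷ [])) (∈-++-comm (z ∷ []) (x ∷ y ∷ [])))))
  ... | inj₂ (inj₂ yz∣x) = ⊥-elim (x≢z (sym
          (consistent-outgroup un c y≢z yz∣x
            (∈-++-comm (x ∷ []) (y ∷ z ∷ [])) (∈-++-comm (y ∷ z ∷ []) (x ∷ [])))))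

  displays-inˡ : Unique (leaves (node l r)) → Displays (node l r) x y z
    → x ∈ leaves l → z ∈ leaves l → Displays l x y z
  displays-inˡ           _  (inL s)        _  _  = s
  displays-inˡ {l = l} un (inR s)        xl _  =
    ⊥-elim (unique-++-disjoint {leaves l} un xl (proj₁ (displays-leaves s)))
  displays-inˡ {l = l} un (rootL _ _ zr) _  zl = ⊥-elim (unique-++-disjoint {leaves l} un zl zr)
  displays-inˡ {l = l} un (rootR xr _ _) xl _  = ⊥-elim (unique-++-disjoint {leaves l} un xl xr)

  displays-inʳ : Unique (leaves (node l r)) → Displays (node l r) x y z
    → x ∈ leaves r → z ∈ leaves r → Displays r x y z
  displays-inʳ           _  (inR s)        _  _  = s
  displays-inʳ {l = l} un (inL s)        xr _  =
    ⊥-elim (unique-++-disjoint {leaves l} un (proj₁ (displays-leaves s)) xr)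
  displays-inʳ {l = l} un (rootL xl _ _) xr _  = ⊥-elim (unique-++-disjoint {leaves l} un xl xr)
  displays-inʳ {l = l} un (rootR _ _ zl) _  zr = ⊥-elim (unique-++-disjoint {leaves l} un zl zr)

  outside-span⇒displays : ∀ X → d ∈ leaves t → d ∉ span X t → x ∈ X → y ∈ X → Displays t x y d
  outside-span⇒displays {t = leaf _} X dm d∉ _ _ = ⊥-elim (d∉ dm)
  outside-span⇒displays {t = node l r} X dm d∉ xX yX
    with all (λ v → elem v (leaves l)) X in eˡ | all (λ v → elem v (leaves r)) X in eʳ
  ... | true | _ with ∈-++⁻ (leaves l) dm
  ...   | inj₁ dl = inL (outside-span⇒displays X dl d∉ xX yX)
  ...   | inj₂ dr = rootL (all-elem⇒⊆ eˡ xX) (all-elem⇒⊆ eˡ yX) dr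
  outside-span⇒displays {t = node l r} X dm d∉ xX yX | false | true with ∈-++⁻ (leaves l) dm
  ...   | inj₁ dl = rootR (all-elem⇒⊆ eʳ xX) (all-elem⇒⊆ eʳ yX) dl
  ...   | inj₂ dr = inR (outside-span⇒displays X dr d∉ xX yX)
  outside-span⇒displays {t = node l r} X dm d∉ xX yX | false | false = ⊥-elim (d∉ dm)

  inside-span : ∀ X → Unique (leaves t) → Displays t x y z
    → x ∈ X → z ∈ X → X ⊆ (x ∷ y ∷ z ∷ []) → d ∈ span X t
    → (Displays t x d z × Displays t y d z) ⊎ (Displays t z d x × Displays t z d y × Displays t x y d)
  inside-span {t = node l r} X un s xX zX X⊆xyz d∈
    with all (λ v → elem v (leaves l)) X in eˡ | all (λ v → elem v (leaves r)) X in eʳ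
  ... | true | _ =
    Sum.map (Product.map inL inL) (Product.map inL (Product.map inL inL))
      (inside-span X (unique-++ˡ un) (displays-inˡ un s (all-elem⇒⊆ eˡ xX) (all-elem⇒⊆ eˡ zX))
        xX zX X⊆xyz d∈)
  ... | false | true =
    Sum.map (Product.map inR inR) (Product.map inR (Product.map inR inR))
      (inside-span X (unique-++ʳ (leaves l) un) (displays-inʳ un s (all-elem⇒⊆ eʳ xX) (all-elem⇒⊆ eʳ zX))
        xX zX X⊆xyz d∈)
  ... | false | false with s
  ...   | inL s' = let xl , yl , zl = displays-leaves s' in
      contradiction (trans (sym eˡ) (⊆⇒all-elem (All.lookup (xl ∷ yl ∷ zl ∷ []) ∘ X⊆xyz))) λ ()
  ...   | inR s' = let xr , yr , zr = displays-leaves s' in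
      contradiction (trans (sym eʳ) (⊆⇒all-elem (All.lookup (xr ∷ yr ∷ zr ∷ []) ∘ X⊆xyz))) λ ()
  ...   | rootL xl yl zr with ∈-++⁻ (leaves l) d∈
  ...     | inj₁ dl = inj₁ (rootL xl dl zr , rootL yl dl zr)
  ...     | inj₂ dr = inj₂ (rootR zr dr xl , rootR zr dr yl , rootL xl yl dr)
  inside-span {t = node l r} X un s xX zX X⊆xyz d∈ | false | false | rootR xr yr zl
    with ∈-++⁻ (leaves l) d∈
  ...     | inj₁ dl = inj₂ (rootL zl dl xr , rootL zl dl yr , rootR xr yr dl)
  ...     | inj₂ dr = inj₁ (rootR xr dr zl , rootR yr dr zl)

  module _ {R : Fin n → Fin n → Fin n → Set} (dense : Dense R) where

    dense-distinct : R x y z → x ≢ y × y ≢ z × x ≢ z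
    dense-distinct = proj₁ dense _ _ _

    dense-swap : R x y z → R y x z
    dense-swap = proj₁ (proj₂ dense) _ _ _

    dense-resolves : x ≢ y → y ≢ z → x ≢ z → R y z x ⊎ R x z y ⊎ R x y z
    dense-resolves x≢y y≢z x≢z = proj₁ (proj₂ (proj₂ dense) _ _ _ x≢y y≢z x≢z)

    dense-exclusive : R x y z → R x z y → ⊥
    dense-exclusive ρ ρ' =
      let x≢y , y≢z , x≢z = dense-distinct ρ
      in proj₂ (proj₂ (proj₂ (proj₂ (proj₂ dense) _ _ _ x≢y y≢z x≢z))) (ρ' , ρ)

module Quartet {n : ℕ} (R : Fin n → Fin n → Fin n → Set) (T : Tree n)
  (dense : Dense R) (over : TreeOver (λ _ → ⊤) T)
  {a b c d : Fin n} (a≢b : a ≢ b) (a≢c : a ≢ c) (a≢d : a ≢ d)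
  (b≢c : b ≢ c) (b≢d : b ≢ d) (c≢d : c ≢ d)
  (Rbca : R b c a) (bca∉T : ¬ ConsistentWith T b c a)
  (only-bca : ∀ x y z → x ∈ (a ∷ b ∷ c ∷ d ∷ []) → y ∈ (a ∷ b ∷ c ∷ d ∷ [])
    → z ∈ (a ∷ b ∷ c ∷ d ∷ []) → R x y z → ¬ ConsistentWith T x y z
    → z ≡ a × ((x ≡ b × y ≡ c) ⊎ (x ≡ c × y ≡ b)))
  where

  open DecMembership (_≟_ {n}) using (_∈?_)

  private variable
    q r v x y z : Fin n

  Q X : List (Fin n)
  Q = a ∷ b ∷ c ∷ d ∷ []
  X = a ∷ b ∷ c ∷ []

  IsBCA : Fin n → Fin n → Fin n → Set
  IsBCA x y z = z ≡ a × ((x ≡ b × y ≡ c) ⊎ (x ≡ c × y ≡ b))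

  unique-T : Unique (leaves T)
  unique-T = proj₁ over

  leaf-of-T : ∀ v → v ∈ leaves T
  leaf-of-T v = Equivalence.from (proj₂ over v) tt

  aX : a ∈ X
  aX = here refl

  bX : b ∈ X
  bX = there (here refl)

  cX : c ∈ X
  cX = there (there (here refl))

  aQ : a ∈ Q
  aQ = here refl

  dQ : d ∈ Q
  dQ = there (there (there (here refl)))

  X⊆Q : x ∈ X → x ∈ Q
  X⊆Q = ∈-++⁺ˡ

  X⊆acb : X ⊆ (a ∷ c ∷ b ∷ [])
  X⊆acb (here e)  = here e
  X⊆acb (there m) = there (∈-++-comm (b ∷ []) (c ∷ []) m)

  X≢d : x ∈ X → x ≢ d
  X≢d = All.lookup (a≢d ∷ b≢d ∷ c≢d ∷ [])

  T-consistent⇒displays : x ≢ y → x ≢ z → y ≢ z → ConsistentWith T x y z → Displays T x y z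
  T-consistent⇒displays x≢y x≢z y≢z =
    consistent⇒displays unique-T x≢y x≢z y≢z (leaf-of-T _) (leaf-of-T _) (leaf-of-T _)

  R⇒displays : x ∈ Q → y ∈ Q → z ∈ Q → R x y z → ¬ IsBCA x y z → Displays T x y z
  R⇒displays {x} {y} {z} xQ yQ zQ ρ ¬bca with dense-distinct dense ρ
  ... | x≢y , y≢z , x≢z with displays-trichotomy x≢y (leaf-of-T x) (leaf-of-T y) (leaf-of-T z)
  ... | inj₁ xy∣z = xy∣z
  ... | inj₂ (inj₁ xz∣y) = ⊥-elim (¬bca (only-bca x y z xQ yQ zQ ρ λ xy∣z∈T →
          displays-exclusive unique-T (T-consistent⇒displays x≢y x≢z y≢z xy∣z∈T) xz∣y))
  ... | inj₂ (inj₂ yz∣x) = ⊥-elim (¬bca (only-bca x y z xQ yQ zQ ρ λ xy∣z∈T →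
          displays-exclusive unique-T
            (displays-swap (T-consistent⇒displays x≢y x≢z y≢z xy∣z∈T)) yz∣x))

  displays⇒R : x ∈ Q → y ∈ Q → z ∈ Q → x ≢ y → y ≢ z → x ≢ z
    → ¬ IsBCA y z x → ¬ IsBCA x z y → Displays T x y z → R x y z
  displays⇒R xQ yQ zQ x≢y y≢z x≢z ¬yzx ¬xzy xy∣z with dense-resolves dense x≢y y≢z x≢z
  ... | inj₁ ρ =
    ⊥-elim (displays-exclusive unique-T (displays-swap xy∣z) (R⇒displays yQ zQ xQ ρ ¬yzx))
  ... | inj₂ (inj₁ ρ) = ⊥-elim (displays-exclusive unique-T xy∣z (R⇒displays xQ zQ yQ ρ ¬xzy))
  ... | inj₂ (inj₂ ρ) = ρ

  ¬IsBCA-d₁ : ¬ IsBCA d y z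
  ¬IsBCA-d₁ (_ , inj₁ (d≡b , _)) = b≢d (sym d≡b)
  ¬IsBCA-d₁ (_ , inj₂ (d≡c , _)) = c≢d (sym d≡c)

  ¬IsBCA-d₂ : ¬ IsBCA x d z
  ¬IsBCA-d₂ (_ , inj₁ (_ , d≡c)) = c≢d (sym d≡c)
  ¬IsBCA-d₂ (_ , inj₂ (_ , d≡b)) = b≢d (sym d≡b)

  ¬IsBCA-d₃ : ¬ IsBCA x y d
  ¬IsBCA-d₃ (d≡a , _) = a≢d (sym d≡a)

  displays⇒R-d-middle : x ∈ X → z ∈ X → x ≢ z → Displays T x d z → R x d z
  displays⇒R-d-middle xX zX x≢z =
    displays⇒R (X⊆Q xX) dQ (X⊆Q zX) (X≢d xX) (X≢d zX ∘ sym) x≢z ¬IsBCA-d₁ ¬IsBCA-d₃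

  displays⇒R-d-last : x ∈ X → y ∈ X → x ≢ y → Displays T x y d → R x y d
  displays⇒R-d-last xX yX x≢y =
    displays⇒R (X⊆Q xX) (X⊆Q yX) dQ x≢y (X≢d yX) (X≢d xX) ¬IsBCA-d₂ ¬IsBCA-d₂

  module _ (T' : Tree n) (over' : TreeOver (InS Q) T')
    (consistent : ∀ x y z → x ∈ Q → y ∈ Q → z ∈ Q → R x y z → ConsistentWith T' x y z) where

    unique-T' : Unique (leaves T')
    unique-T' = proj₁ over'

    Q⊆T' : v ∈ Q → v ∈ leaves T'
    Q⊆T' = Equivalence.from (proj₂ over' _)

    R⇒displays' : x ∈ Q → y ∈ Q → z ∈ Q → R x y z → Displays T' x y z
    R⇒displays' xQ yQ zQ ρ =
      let x≢y , y≢z , x≢z = dense-distinct dense ρ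
      in consistent⇒displays unique-T' x≢y x≢z y≢z (Q⊆T' xQ) (Q⊆T' yQ) (Q⊆T' zQ)
           (consistent _ _ _ xQ yQ zQ ρ)

    d∈span-refutes : q ∈ X → r ∈ X → a ≢ q → a ≢ r → q ≢ r
      → R q r a → Displays T a q r → X ⊆ (a ∷ q ∷ r ∷ []) → d ∈ span X T → ⊥
    d∈span-refutes qX rX a≢q a≢r q≢r qr∣a aq∣r X⊆aqr d∈span
      with inside-span X unique-T aq∣r (here refl) rX X⊆aqr d∈span
         | displays-insert q≢r (R⇒displays' (X⊆Q qX) (X⊆Q rX) aQ qr∣a) (Q⊆T' dQ)
    ... | inj₁ (ad∣r , qd∣r) | inj₁ qr∣d =
      displays-exclusive unique-T' qr∣d
        (R⇒displays' (X⊆Q qX) dQ (X⊆Q rX) (displays⇒R-d-middle qX rX q≢r qd∣r))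
    ... | inj₁ (ad∣r , _) | inj₂ (_ , rd∣a) =
      displays-exclusive unique-T'
        (displays-swap (R⇒displays' aQ dQ (X⊆Q rX) (displays⇒R-d-middle aX rX a≢r ad∣r)))
        (displays-swap rd∣a)
    ... | inj₂ (_ , rd∣q , _) | inj₁ qr∣d =
      displays-exclusive unique-T' (displays-swap qr∣d)
        (R⇒displays' (X⊆Q rX) dQ (X⊆Q qX) (displays⇒R-d-middle rX qX (q≢r ∘ sym) rd∣q))
    ... | inj₂ (_ , _ , aq∣d) | inj₂ (qd∣a , _) =
      displays-exclusive unique-T'
        (displays-swap (R⇒displays' aQ (X⊆Q qX) dQ (displays⇒R-d-last aX qX a≢q aq∣d)))
        qd∣a

  d∈span⇒conflict : d ∈ span X T → ¬ ConsistentOn R Q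
  d∈span⇒conflict d∈span (T' , over' , consistent)
    with displays-trichotomy a≢b (leaf-of-T a) (leaf-of-T b) (leaf-of-T c)
  ... | inj₁ ab∣c =
    d∈span-refutes T' over' consistent bX cX a≢b a≢c b≢c Rbca ab∣c id d∈span
  ... | inj₂ (inj₁ ac∣b) =
    d∈span-refutes T' over' consistent cX bX a≢c a≢b (b≢c ∘ sym) (dense-swap dense Rbca) ac∣b X⊆acb
      d∈span
  ... | inj₂ (inj₂ bc∣a) = bca∉T (displays⇒consistent unique-T b≢c bc∣a)

  -- Listing a first makes the leaves of this tree literally Q.
  witness : Tree n
  witness = node (node (leaf a) (node (leaf b) (leaf c))) (leaf d)

  witness-over : TreeOver (InS Q) witness
  witness-over =
    ((a≢b ∷ a≢c ∷ a≢d ∷ []) ∷ (b≢c ∷ b≢d ∷ []) ∷ (c≢d ∷ []) ∷ [] ∷ []) , λ _ → mk⇔ id id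

  module _ (d∉span : d ∉ span X T) where

    witness-displays⇒R : x ≢ y → Displays witness x y z → R x y z
    witness-displays⇒R x≢y (rootL xX yX (here refl)) =
      displays⇒R-d-last xX yX x≢y (outside-span⇒displays X (leaf-of-T d) d∉span xX yX)
    witness-displays⇒R _ (inL (rootR (here refl) (there (here refl)) (here refl))) = Rbca
    witness-displays⇒R _ (inL (rootR (there (here refl)) (here refl) (here refl))) = dense-swap dense Rbca
    witness-displays⇒R x≢y (inL (rootR (here refl) (here refl) _)) = ⊥-elim (x≢y refl)
    witness-displays⇒R x≢y (inL (rootR (there (here refl)) (there (here refl)) _)) = ⊥-elim (x≢y refl)
    witness-displays⇒R x≢y (inL (rootL (here refl) (here refl) _)) = ⊥-elim (x≢y refl)
    witness-displays⇒R x≢y (inL (inR (rootL (here refl) (here refl) _))) = ⊥-elim (x≢y refl)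
    witness-displays⇒R x≢y (inL (inR (rootR (here refl) (here refl) _))) = ⊥-elim (x≢y refl)
    witness-displays⇒R x≢y (rootR (here refl) (here refl) _) = ⊥-elim (x≢y refl)

    witness-consistent : ∀ x y z → x ∈ Q → y ∈ Q → z ∈ Q → R x y z → ConsistentWith witness x y z
    witness-consistent x y z xQ yQ zQ ρ with dense-distinct dense ρ
    ... | x≢y , y≢z , x≢z with displays-trichotomy x≢y xQ yQ zQ
    ... | inj₁ xy∣z        = displays⇒consistent (proj₁ witness-over) x≢y xy∣z
    ... | inj₂ (inj₁ xz∣y) = ⊥-elim (dense-exclusive dense ρ (witness-displays⇒R x≢z xz∣y))
    ... | inj₂ (inj₂ yz∣x) =
      ⊥-elim (dense-exclusive dense (dense-swap dense ρ) (witness-displays⇒R y≢z yz∣x))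

  conflict⇒d∈span : ¬ ConsistentOn R Q → d ∈ span X T
  conflict⇒d∈span conflict =
    decidable-stable (d ∈? span X T) λ d∉span →
      conflict (witness , witness-over , witness-consistent d∉span)

lemma5 : (n : ℕ) (R : Fin n → Fin n → Fin n → Set) (T : Tree n)
    → Dense R
    → TreeOver (λ _ → ⊤) T
    → (a b c d : Fin n)
    → a ≢ b → a ≢ c → a ≢ d → b ≢ c → b ≢ d → c ≢ d
    → R b c a
    → ¬ ConsistentWith T b c a
    → (∀ x y z → x ∈ (a ∷ b ∷ c ∷ d ∷ []) → y ∈ (a ∷ b ∷ c ∷ d ∷ [])
         → z ∈ (a ∷ b ∷ c ∷ d ∷ []) → R x y z → ¬ ConsistentWith T x y z
         → z ≡ a × ((x ≡ b × y ≡ c) ⊎ (x ≡ c × y ≡ b)))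
    → (¬ ConsistentOn R (a ∷ b ∷ c ∷ d ∷ []))
        ⇔ (d ∈ span (a ∷ b ∷ c ∷ []) T)
lemma5 _ R T dense over _ _ _ _ a≢b a≢c a≢d b≢c b≢d c≢d Rbca bca∉T only-bca =
  mk⇔ conflict⇒d∈span d∈span⇒conflict
  where open Quartet R T dense over a≢b a≢c a≢d b≢c b≢d c≢d Rbca bca∉T only-bca
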